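{- For every pre-cellular morphism $h\colon\gamma\to\delta$ between cellular automata $\gamma\colon X\to CX$ and $\delta\colon Y\to CY$, one has $h^*\circ G_\delta=G_\gamma\circ h^*$ as maps $Y^*\to X^*$. That is, the global rule is a natural transformation from the configuration functor to itself on the category of cellular automata and pre-cellular morphisms.
   Context: Fix a monoid $(M,\cdot,e)$, a subset $N\subseteq M$ with inclusion $i\colon N\hookrightarrow M$, and a set $S$ of states. $[A,B]$ is the set of maps $A\to B$. For $a\colon M\to X$ let $I^a\subseteq[N,S]$ be the set of $f\colon N\to S$ with $f(n)=f(n')$ whenever $a(i(n))=a(i(n'))$; for $h\colon X\to Y$, $I^{h\circ a}\subseteq I^a$. Let $CX=\coprod_{a\colon M\to X}[I^a,S]$, $(Ch)(a,f)=(h\circ a, f|_{I^{h\circ a}})$. A cellular automaton is $\gamma\colon X\to CX$, $\gamma(x)=(\gamma_1(x),\gamma_2(x))$ with $\gamma_1(x)\colon M\to X$, $\gamma_2(x)\colon I^{\gamma_1(x)}\to S$, such that $\gamma_1(x)(e)=x$ and $\gamma_1(\gamma_1(x)(m))(n)=\gamma_1(x)(n\cdot m)$. A pre-cellular morphism $h\colon\gamma\to\delta$ is a map $h\colon X\to Y$ with $Ch\circ\gamma=\delta\circ h$. Configurations $X^*=[X,S]$; for $h\colon X\to Y$, $h^*\colon Y^*\to X^*$, $h^*(c)=c\circ h$. The global rule is $G_\gamma\colon X^*\to X^*$, $G_\gamma(c)=e_S\circ Cc\circ\gamma$ where $e_S\colon CS\to S$, $e_S(a,f)=f(a\circ i)$;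 explicitly $G_\gamma(c)(x)=\gamma_2(x)(c\circ\gamma_1(x)\circ i)$. -}

module Defs where

open import Data.Product using (Σ; _,_; proj₁; proj₂)
open import Function using (_∘_)
open import Relation.Binary.PropositionalEquality using (_≡_; cong)

-- The setting: a monoid carrier M with multiplication _·_ and unit e
-- (monoid laws are assumed in the statement), a subset N ⊆ M given as a
-- predicate, with inclusion i = proj₁, and a set S of states.
module CA (M : Set) (_·_ : M → M → M) (e : M) (N : M → Set) (S : Set) where

  Sub : Set
  Sub = Σ M N

  i : Sub → M
  i = proj₁

  -- I^a ⊆ [N,S]: maps f : N → S with f n = f n' whenever a(i n) = a(i n').
  -- The membership proof is irrelevant, since I^a is a subset.
  record I {X : Set} (a : M → X) : Set where
    constructor mkI
    field
      fun  : Sub → S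
      .resp : ∀ n n' → a (i n) ≡ a (i n') → fun n ≡ fun n'
  open I public

  incl : {X Y : Set} (h : X → Y) (a : M → X) → I (h ∘ a) → I a
  incl h a (mkI f p) = mkI f (λ n n' eq → p n n' (cong h eq))

  C : Set → Set
  C X = Σ (M → X) (λ a → I a → S)

  Cmap : {X Y : Set} → (X → Y) → C X → C Y
  Cmap h (a , f) = (h ∘ a , f ∘ incl h a)

  record CellularAutomaton (X : Set) : Set where
    field
      γ : X → C X
      γ-unit : ∀ x → proj₁ (γ x) e ≡ x
      γ-comp : ∀ x m n → proj₁ (γ (proj₁ (γ x) m)) n ≡ proj₁ (γ x) (n · m)
  open CellularAutomaton public

  γ₁ : {X : Set} → (X → C X) → X → M → X
  γ₁ g x = proj₁ (g x)

  γ₂ : {X : Set} (g : X → C X) (x : X) → I (γ₁ g x) → S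
  γ₂ g x = proj₂ (g x)

  IsPreCellular : {X Y : Set} → CellularAutomaton X → CellularAutomaton Y
                → (X → Y) → Set
  IsPreCellular {X} Γ Δ h = ∀ (x : X) → Cmap h (γ Γ x) ≡ γ Δ (h x)

  Conf : Set → Set
  Conf X = X → S

  _* : {X Y : Set} → (X → Y) → Conf Y → Conf X
  (h *) c = c ∘ h

  eS : C S → S
  eS (a , f) = f (mkI (a ∘ i) (λ n n' eq → eq))

  G : {X : Set} → CellularAutomaton X → Conf X → Conf X
  G Γ c = eS ∘ Cmap c ∘ γ Γ

{-# OPTIONS --safe #-}
module Submission where

-- Naturality is the functoriality of C: G_γ (c ∘ h) = e_S ∘ C(c ∘ h) ∘ γ
-- = e_S ∘ C c ∘ C h ∘ γ = e_S ∘ C c ∘ δ ∘ h = G_δ(c) ∘ h.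

open import Defs
open import Algebra.Structures using (IsMonoid)
open import Function using (_∘_)
open import Relation.Binary.PropositionalEquality using (_≡_; refl; cong; module ≡-Reasoning)

module GlobalRule (M : Set) (_·_ : M → M → M) (e : M) (N : M → Set) (S : Set) where

  open CA M _·_ e N S

  -- Holds definitionally because membership in I^a is irrelevant.
  Cmap-∘ : {X Y Z : Set} (g : Y → Z) (h : X → Y) (p : C X) →
           Cmap g (Cmap h p) ≡ Cmap (g ∘ h) p
  Cmap-∘ g h p = refl

  G-natural : {X Y : Set} (Γ : CellularAutomaton X) (Δ : CellularAutomaton Y)
              (h : X → Y) → IsPreCellular Γ Δ h →
              ∀ (c : Conf Y) (x : X) → (h *) (G Δ c) x ≡ G Γ ((h *) c) x
  G-natural Γ Δ h h-pre c x = begin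
    eS (Cmap c (γ Δ (h x)))          ≡⟨ cong (eS ∘ Cmap c) (h-pre x) ⟨
    eS (Cmap c (Cmap h (γ Γ x)))     ≡⟨ cong eS (Cmap-∘ c h (γ Γ x)) ⟩
    eS (Cmap (c ∘ h) (γ Γ x))        ∎
    where open ≡-Reasoning

lemma3 : (M : Set) (_·_ : M → M → M) (e : M) → IsMonoid _≡_ _·_ e →
    (N : M → Set) (S : Set) →
    let open CA M _·_ e N S in
    {X Y : Set} (Γ : CellularAutomaton X) (Δ : CellularAutomaton Y) (h : X → Y) →
    IsPreCellular Γ Δ h →
    ∀ (c : Conf Y) (x : X) → (h *) (G Δ c) x ≡ G Γ ((h *) c) x
lemma3 M _·_ e _ N S = GlobalRule.G-natural M _·_ e N S
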